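{- For every integer $n\ge 1$, there is a bijection between the set of isomorphism classes of unbalanced $XY$-graphs on $n$ vertices and the set of isomorphism classes of $XY$-graphs (balanced or unbalanced) on $t$ vertices, where $t$ ranges over $0\le t\le n-1$.
   Context: An $XY$-graph is a bipartite graph together with a specified ordered bipartition $X\cup Y$ of its vertex set (every edge joins $X$ to $Y$; either part may be empty); isomorphisms of $XY$-graphs must map $X$ onto $X'$ and $Y$ onto $Y'$. A vertex of $Y$ is an isolate if it has no neighbor; a vertex of $X$ is universal if it is adjacent to every vertex of $Y$. Balance is defined only for $XY$-graphs with no isolates in $Y$: such an $XY$-graph is unbalanced if $X$ contains a universal vertex and balanced otherwise. Thus "balanced or unbalanced $XY$-graph" means an $XY$-graph with no isolates in $Y$. -}

module Defs where

open import Data.Nat using (ℕ; _+_; _<_; _≤_)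
open import Data.Fin using (Fin)
open import Data.Bool using (Bool; true; false)
open import Data.Product using (Σ; ∃; _×_; _,_; proj₁)
open import Relation.Nullary using (¬_)
open import Relation.Binary.PropositionalEquality using (_≡_)
open import Function.Bundles using (_↔_; Inverse)

record XYGraph : Set where
  constructor mkXY
  field
    sizeX : ℕ
    sizeY : ℕ
    adj   : Fin sizeX → Fin sizeY → Bool

open XYGraph public

order : XYGraph → ℕ
order G = sizeX G + sizeY G

_≅_ : XYGraph → XYGraph → Set
G ≅ H = Σ (Fin (sizeX G) ↔ Fin (sizeX H)) λ σ →
        Σ (Fin (sizeY G) ↔ Fin (sizeY H)) λ τ →
        ∀ x y → adj G x y ≡ adj H (Inverse.to σ x) (Inverse.to τ y)

IsIsolate : (G : XYGraph) → Fin (sizeY G) → Set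
IsIsolate G y = ∀ x → adj G x y ≡ false

NoIsolates : XYGraph → Set
NoIsolates G = ∀ y → ¬ IsIsolate G y

IsUniversal : (G : XYGraph) → Fin (sizeX G) → Set
IsUniversal G x = ∀ y → adj G x y ≡ true

Unbalanced : XYGraph → Set
Unbalanced G = NoIsolates G × ∃ λ x → IsUniversal G x

Balanced : XYGraph → Set
Balanced G = NoIsolates G × (∀ x → ¬ IsUniversal G x)

UnbalancedOn : ℕ → Set
UnbalancedOn n = Σ XYGraph λ G → order G ≡ n × Unbalanced G

-- balanced or unbalanced XY-graphs (i.e. no isolates in Y) on t vertices, 0 ≤ t ≤ n-1
NoIsolatesBelow : ℕ → Set
NoIsolatesBelow n = Σ XYGraph λ G → order G < n × NoIsolates G

-- A bijection between the sets of isomorphism classes of A and B, given by a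
-- map f on representatives that is well defined on classes, injective on classes
-- and surjective on classes.
IsoClassBijection : {A B : Set} → (A → XYGraph) → (B → XYGraph) → (A → B) → Set
IsoClassBijection {A} {B} gA gB f =
  (∀ a a' → gA a ≅ gA a' → gB (f a) ≅ gB (f a')) ×
  (∀ a a' → gB (f a) ≅ gB (f a') → gA a ≅ gA a') ×
  (∀ b → ∃ λ a → gB (f a) ≅ gB b)

module Submission where

-- Forward map (the "core"): given an unbalanced G with universal vertex u, delete u
-- together with the Y-vertices whose only neighbour is u (the pendants of u).  What
-- remains has no isolates and fewer vertices.  Backward map: given H, add an apex
-- adjacent to all of Y and to n - 1 - |H| new pendant Y-vertices.
--
-- The three parts of the bijection are then:
--   well defined: the core does not depend on the chosen universal vertex, because
--     a transposition of two universal vertices is an automorphism ('core-invariant');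
--   injective: every unbalanced graph is the cone over its core with the right number
--     of pendants, which the order n determines ('decomposition');
--   surjective: the core of the cone over H is H again ('core-extend').

open import Defs
open import Data.Bool using (Bool; true; false; not; T)
open import Data.Bool.Properties using (T-irrelevant; ¬-not)
import Data.Bool.Properties as Bool
open import Data.Fin using (Fin; zero; suc; splitAt)
open import Data.Fin.Permutation using (transpose; ↔⇒≡; cast-id)
open import Data.Fin.Properties using (_≟_; any?; +↔⊎)
open import Data.Nat using (ℕ; zero; suc; _+_; _∸_; _<_; _≤_; s≤s)
open import Data.Nat.Properties using (+-assoc; +-cancelˡ-≡; suc-injective; m≤m+n; m+[n∸m]≡n)
open import Data.Product using (Σ; ∃; _×_; _,_; proj₁; proj₂)
open import Data.Sum using (_⊎_; inj₁; inj₂; [_,_]′)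
open import Data.Sum.Function.Propositional using (_⊎-↔_)
open import Data.Unit using (⊤; tt)
open import Function using (_∘_; const)
open import Function.Bundles using (_↔_; _⇔_; Inverse; Equivalence; Injection; mk↔ₛ′; mk⇔)
open import Function.Construct.Identity using (⇔-id)
open import Function.Properties.Inverse using (↔-refl; ↔-sym; ↔-trans; ↔⇒↣)
open import Function.Related.TypeIsomorphisms using (Σ-distribˡ-⊎)
open import Level using (0ℓ) renaming (suc to lsuc)
open import Relation.Binary.Bundles using (Setoid)
open import Relation.Binary.PropositionalEquality
  using (_≡_; refl; sym; trans; cong; cong₂; subst; module ≡-Reasoning)
import Relation.Binary.Reasoning.Setoid as SetoidReasoning
open import Relation.Nullary using (Dec; yes; no; ¬_; contradiction)
open import Relation.Nullary.Decidable
  using (True; False; isYes; toWitness; fromWitness; toWitnessFalse; fromWitnessFalse; _×-dec_; ¬?)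

open Inverse using (to; from; strictlyInverseˡ; strictlyInverseʳ)

Subtype : {A : Set} → (A → Bool) → Set
Subtype {A} p = Σ A (T ∘ p)

subtype-≡ : {A : Set} {p : A → Bool} {a a' : A} {t : T (p a)} {t' : T (p a')} →
            a ≡ a' → _≡_ {A = Subtype p} (a , t) (a' , t')
subtype-≡ {t = t} {t'} refl = cong (_ ,_) (T-irrelevant t t')

subtype-↔ : {A A' : Set} {p : A → Bool} {p' : A' → Bool} (σ : A ↔ A') →
            (∀ a → T (p a) ⇔ T (p' (to σ a))) → Subtype p ↔ Subtype p'
subtype-↔ {p' = p'} σ p⇔p' = mk↔ₛ′
  (λ (a , t) → to σ a , Equivalence.to (p⇔p' a) t)
  (λ (a' , t') → from σ a' ,
     Equivalence.from (p⇔p' (from σ a')) (subst (T ∘ p') (sym (strictlyInverseˡ σ a')) t'))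
  (λ _ → subtype-≡ (strictlyInverseˡ σ _))
  (λ _ → subtype-≡ (strictlyInverseʳ σ _))

-- Every Boolean is true or false, and in exactly one way ('decide-unique'); this
-- makes the fibres of 'partition' contractible.
decide : ∀ b → T b ⊎ T (not b)
decide true  = inj₁ tt
decide false = inj₂ tt

decide-unique : ∀ b (t : T b ⊎ T (not b)) → decide b ≡ t
decide-unique true  (inj₁ tt) = refl
decide-unique false (inj₂ tt) = refl

partition : {A : Set} (p : A → Bool) → A ↔ (Subtype p ⊎ Subtype (not ∘ p))
partition p = ↔-trans
  (mk↔ₛ′ (λ a → a , decide (p a)) proj₁
         (λ (a , t) → cong (a ,_) (decide-unique (p a) t)) (λ _ → refl))
  Σ-distribˡ-⊎

sucFin : ∀ {k} → Fin (suc k) ↔ (⊤ ⊎ Fin k)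
sucFin = mk↔ₛ′ (λ { zero → inj₁ tt ; (suc i) → inj₂ i }) [ (λ _ → zero) , suc ]′
  (λ { (inj₁ tt) → refl ; (inj₂ _) → refl }) (λ { zero → refl ; (suc _) → refl })

Finite : Set → Set
Finite A = Σ ℕ λ k → A ↔ Fin k

T⊎Fin-finite : ∀ b k → Finite (T b ⊎ Fin k)
T⊎Fin-finite true  k = suc k , ↔-sym sucFin
T⊎Fin-finite false k =
  k , mk↔ₛ′ [ (λ ()) , (λ i → i) ]′ inj₂ (λ _ → refl) (λ { (inj₁ ()) ; (inj₂ _) → refl })

Σ-Fin-suc : ∀ {n} (P : Fin (suc n) → Set) → Σ (Fin (suc n)) P ↔ (P zero ⊎ Σ (Fin n) (P ∘ suc))
Σ-Fin-suc P = mk↔ₛ′ (λ { (zero , q) → inj₁ q ; (suc i , q) → inj₂ (i , q) })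
  [ (zero ,_) , (λ (i , q) → suc i , q) ]′
  (λ { (inj₁ _) → refl ; (inj₂ _) → refl }) (λ { (zero , _) → refl ; (suc _ , _) → refl })

subtype-finite : ∀ {n} (p : Fin n → Bool) → Finite (Subtype p)
subtype-finite {zero}  p = zero , mk↔ₛ′ (λ ()) (λ ()) (λ ()) (λ ())
subtype-finite {suc n} p with subtype-finite (p ∘ suc)
... | k , σ with T⊎Fin-finite (p zero) k
...   | k' , ρ = k' , ↔-trans (Σ-Fin-suc (T ∘ p)) (↔-trans (↔-refl ⊎-↔ σ) ρ)

True-cong : {A B : Set} (a? : Dec A) (b? : Dec B) → A ⇔ B → True a? ⇔ True b?
True-cong a? b? A⇔B = mk⇔ (fromWitness ∘ Equivalence.to A⇔B ∘ toWitness {a? = a?})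
                           (fromWitness ∘ Equivalence.from A⇔B ∘ toWitness {a? = b?})

False-cong : {A B : Set} (a? : Dec A) (b? : Dec B) → A ⇔ B → False a? ⇔ False b?
False-cong a? b? A⇔B =
  mk⇔ (λ f → fromWitnessFalse (toWitnessFalse {a? = a?} f ∘ Equivalence.from A⇔B))
      (λ f → fromWitnessFalse (toWitnessFalse {a? = b?} f ∘ Equivalence.to A⇔B))

-- A bipartite graph on arbitrary vertex types: subsets of Fin-types such as the
-- core of a graph are vertex types of this kind.
record Bigraph : Set₁ where
  constructor bigraph
  field
    X Y  : Set
    edge : X → Y → Bool

open Bigraph

-- Isomorphism of bigraphs; on the image of 'fromXY' it unfolds to '_≅_' of Defs.
_≃_ : Bigraph → Bigraph → Set
G ≃ H = Σ (X G ↔ X H) λ σ → Σ (Y G ↔ Y H) λ τ →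
        ∀ x y → edge G x y ≡ edge H (to σ x) (to τ y)

onX : {G H : Bigraph} → G ≃ H → X G ↔ X H
onX = proj₁

onY : {G H : Bigraph} → G ≃ H → Y G ↔ Y H
onY = proj₁ ∘ proj₂

≃-refl : {G : Bigraph} → G ≃ G
≃-refl = ↔-refl , ↔-refl , λ _ _ → refl

≃-sym : {G H : Bigraph} → G ≃ H → H ≃ G
≃-sym {G} {H} (σ , τ , e) = ↔-sym σ , ↔-sym τ , λ x y → sym (begin
  edge G (from σ x) (from τ y)
    ≡⟨ e (from σ x) (from τ y) ⟩
  edge H (to σ (from σ x)) (to τ (from τ y))
    ≡⟨ cong₂ (edge H) (strictlyInverseˡ σ x) (strictlyInverseˡ τ y) ⟩
  edge H x y
    ∎)
  where open ≡-Reasoning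

≃-trans : {G H K : Bigraph} → G ≃ H → H ≃ K → G ≃ K
≃-trans (σ , τ , e) (σ' , τ' , e') =
  ↔-trans σ σ' , ↔-trans τ τ' , λ x y → trans (e x y) (e' (to σ x) (to τ y))

≃-setoid : Setoid (lsuc 0ℓ) 0ℓ
≃-setoid = record { Carrier = Bigraph ; _≈_ = _≃_
                  ; isEquivalence = record { refl = λ {G} → ≃-refl {G}
                                         ; sym = λ {G} {H} → ≃-sym {G} {H}
                                         ; trans = λ {G} {H} {K} → ≃-trans {G} {H} {K} } }

module ≃-Reasoning = SetoidReasoning ≃-setoid

fromXY : XYGraph → Bigraph
fromXY G = bigraph (Fin (sizeX G)) (Fin (sizeY G)) (adj G)

number : (G : Bigraph) {a b : ℕ} → X G ↔ Fin a → Y G ↔ Fin b → XYGraph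
number G {a} {b} σ τ = mkXY a b (λ i j → edge G (from σ i) (from τ j))

number-≃ : (G : Bigraph) {a b : ℕ} (σ : X G ↔ Fin a) (τ : Y G ↔ Fin b) → G ≃ fromXY (number G σ τ)
number-≃ G σ τ = σ , τ , λ x y → sym (cong₂ (edge G) (strictlyInverseʳ σ x) (strictlyInverseʳ τ y))

≅-order : {G H : XYGraph} → G ≅ H → order G ≡ order H
≅-order (σ , τ , _) = cong₂ _+_ (↔⇒≡ σ) (↔⇒≡ τ)

-- Constructive form of 'no isolates': every Y-vertex comes with a neighbour.
HasNeighbours : Bigraph → Set
HasNeighbours G = ∀ y → ∃ λ x → edge G x y ≡ true

noIsolates-≃ : {G : Bigraph} {H : XYGraph} → G ≃ fromXY H → HasNeighbours G → NoIsolates H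
noIsolates-≃ {G} {H} (σ , τ , e) nbrs j isolated with nbrs (from τ j)
... | x , x~y = contradiction (begin
  true                                 ≡⟨ sym x~y ⟩
  edge G x (from τ j)                  ≡⟨ e x (from τ j) ⟩
  adj H (to σ x) (to τ (from τ j))     ≡⟨ cong (adj H (to σ x)) (strictlyInverseˡ τ j) ⟩
  adj H (to σ x) j                     ≡⟨ isolated (to σ x) ⟩
  false                                ∎) λ ()
  where open ≡-Reasoning

induced : (G : Bigraph) → (X G → Bool) → (Y G → Bool) → Bigraph
induced G p q = bigraph (Subtype p) (Subtype q) (λ a b → edge G (proj₁ a) (proj₁ b))

induced-≃ : {G H : Bigraph} (φ : G ≃ H) {p : X G → Bool} {q : Y G → Bool}
            {p' : X H → Bool} {q' : Y H → Bool} →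
            (∀ x → T (p x) ⇔ T (p' (to (onX {G} {H} φ) x))) →
            (∀ y → T (q y) ⇔ T (q' (to (onY {G} {H} φ) y))) →
            induced G p q ≃ induced H p' q'
induced-≃ (σ , τ , e) p⇔p' q⇔q' =
  subtype-↔ σ p⇔p' , subtype-↔ τ q⇔q' , λ a b → e (proj₁ a) (proj₁ b)

inLeft : {A B : Set} → A ⊎ B → Bool
inLeft = [ const true , const false ]′

inRight : {A B : Set} → A ⊎ B → Bool
inRight = not ∘ inLeft

cone : Bigraph → Set → Bigraph
cone H C = bigraph (⊤ ⊎ X H) (Y H ⊎ C) coneEdge
  where
  coneEdge : ⊤ ⊎ X H → Y H ⊎ C → Bool
  coneEdge (inj₁ _) _        = true
  coneEdge (inj₂ x) (inj₁ y) = edge H x y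
  coneEdge (inj₂ x) (inj₂ c) = false

cone-≃ : {H H' : Bigraph} {C C' : Set} → H ≃ H' → C ↔ C' → cone H C ≃ cone H' C'
cone-≃ (σ , τ , e) ρ = (↔-refl ⊎-↔ σ) , (τ ⊎-↔ ρ) , λ
  { (inj₁ _) _        → refl
  ; (inj₂ x) (inj₁ y) → e x y
  ; (inj₂ x) (inj₂ c) → refl }

cone-base : (H : Bigraph) (C : Set) → induced (cone H C) inRight inLeft ≃ H
cone-base H C = X-iso , Y-iso , λ { (inj₂ x , _) (inj₁ y , _) → refl ; (inj₁ _ , ()) _ ; _ (inj₂ _ , ()) }
  where
  X-iso : Subtype {⊤ ⊎ X H} inRight ↔ X H
  X-iso = mk↔ₛ′ (λ { (inj₂ x , _) → x ; (inj₁ _ , ()) }) (λ x → inj₂ x , tt) (λ _ → refl)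
                (λ { (inj₂ x , _) → refl ; (inj₁ _ , ()) })
  Y-iso : Subtype {Y H ⊎ C} inLeft ↔ Y H
  Y-iso = mk↔ₛ′ (λ { (inj₁ y , _) → y ; (inj₂ _ , ()) }) (λ y → inj₁ y , tt) (λ _ → refl)
                (λ { (inj₁ y , _) → refl ; (inj₂ _ , ()) })

transpose-maps : ∀ {n} (i j : Fin n) → to (transpose i j) i ≡ j
transpose-maps i j with i ≟ i
... | yes _  = refl
... | no i≢i = contradiction refl i≢i

transpose-respects : ∀ {n} {A : Set} (f : Fin n → A) {i j : Fin n} → f i ≡ f j →
                     ∀ k → f k ≡ f (to (transpose i j) k)
transpose-respects f {i} {j} fi≡fj k with k ≟ i
... | yes refl = fi≡fj
... | no _ with k ≟ j
...   | yes refl = sym fi≡fj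
...   | no _     = refl

universal-swap : (G : XYGraph) {v w : Fin (sizeX G)} → IsUniversal G v → IsUniversal G w →
                 Σ (G ≅ G) λ φ → to (proj₁ φ) v ≡ w
universal-swap G {v} {w} univ-v univ-w =
  (transpose v w , ↔-refl , λ x y →
     transpose-respects (λ z → adj G z y) (trans (univ-v y) (sym (univ-w y))) x) ,
  transpose-maps v w

universal-≅ : {G H : XYGraph} (φ : G ≅ H) {u : Fin (sizeX G)} →
              IsUniversal G u → IsUniversal H (to (proj₁ φ) u)
universal-≅ {G} {H} (σ , τ , e) {u} univ y = begin
  adj H (to σ u) y                ≡⟨ cong (adj H (to σ u)) (strictlyInverseˡ τ y) ⟨
  adj H (to σ u) (to τ (from τ y)) ≡⟨ e u (from τ y) ⟨
  adj G u (from τ y)              ≡⟨ univ (from τ y) ⟩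
  true                            ∎
  where open ≡-Reasoning

module Core (G : XYGraph) (u : Fin (sizeX G)) where

  OtherNeighbour : Fin (sizeY G) → Set
  OtherNeighbour y = ∃ λ x → ¬ x ≡ u × adj G x y ≡ true

  otherNeighbour? : ∀ y → Dec (OtherNeighbour y)
  otherNeighbour? y = any? λ x → ¬? (x ≟ u) ×-dec (adj G x y Bool.≟ true)

  isApex : Fin (sizeX G) → Bool
  isApex x = isYes (x ≟ u)

  keepX : Fin (sizeX G) → Bool
  keepX = not ∘ isApex

  keepY : Fin (sizeY G) → Bool
  keepY y = isYes (otherNeighbour? y)

  core : Bigraph
  core = induced (fromXY G) keepX keepY

  core-hasNeighbours : HasNeighbours core
  core-hasNeighbours (y , kept) with toWitness {a? = otherNeighbour? y} kept
  ... | x , x≢u , x~y = (x , fromWitnessFalse x≢u) , x~y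

  apex-unique : Subtype isApex ↔ ⊤
  apex-unique = mk↔ₛ′ (const tt) (λ _ → u , fromWitness refl) (λ _ → refl)
                      (λ (x , t) → subtype-≡ (sym (toWitness {a? = x ≟ u} t)))

  X-split : Fin (sizeX G) ↔ (⊤ ⊎ Subtype keepX)
  X-split = ↔-trans (partition isApex) (apex-unique ⊎-↔ ↔-refl)

  Y-split : Fin (sizeY G) ↔ (Subtype keepY ⊎ Subtype (not ∘ keepY))
  Y-split = partition keepY

  kX kY pendants : ℕ
  kX       = proj₁ (subtype-finite keepX)
  kY       = proj₁ (subtype-finite keepY)
  pendants = proj₁ (subtype-finite (not ∘ keepY))

  numberX : Subtype keepX ↔ Fin kX
  numberX = proj₂ (subtype-finite keepX)

  numberY : Subtype keepY ↔ Fin kY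
  numberY = proj₂ (subtype-finite keepY)

  numberPendants : Subtype (not ∘ keepY) ↔ Fin pendants
  numberPendants = proj₂ (subtype-finite (not ∘ keepY))

  coreXY : XYGraph
  coreXY = number core numberX numberY

  core≃coreXY : core ≃ fromXY coreXY
  core≃coreXY = number-≃ core numberX numberY

  coreXY-noIsolates : NoIsolates coreXY
  coreXY-noIsolates = noIsolates-≃ core≃coreXY core-hasNeighbours

  order-split : order G ≡ suc (order coreXY + pendants)
  order-split = begin
    sizeX G + sizeY G     ≡⟨ cong₂ _+_ (↔⇒≡ X-count) (↔⇒≡ Y-count) ⟩
    suc kX + (kY + pendants) ≡⟨ cong suc (+-assoc kX kY pendants) ⟨
    suc (kX + kY + pendants) ∎
    where
    open ≡-Reasoning
    X-count : Fin (sizeX G) ↔ Fin (suc kX)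
    X-count = ↔-trans X-split (↔-trans (↔-refl ⊎-↔ numberX) (↔-sym sucFin))
    Y-count : Fin (sizeY G) ↔ Fin (kY + pendants)
    Y-count = ↔-trans Y-split (↔-trans (numberY ⊎-↔ numberPendants) (↔-sym +↔⊎))

  coreXY-smaller : ∀ {n} → order G ≡ n → order coreXY < n
  coreXY-smaller order≡n =
    subst (order coreXY <_) (trans (sym order-split) order≡n) (s≤s (m≤m+n (order coreXY) pendants))

  -- If u is universal then G is the cone over its core with its pendants: u is
  -- adjacent to everything and the pendants to nothing but u.
  decomposition : IsUniversal G u → fromXY G ≃ cone (fromXY coreXY) (Fin pendants)
  decomposition univ = begin
    fromXY G                             ≈⟨ ≃-sym {cone core Pendants} {fromXY G} split ⟩
    cone core Pendants                   ≈⟨ cone-≃ {core} {fromXY coreXY} core≃coreXY numberPendants ⟩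
    cone (fromXY coreXY) (Fin pendants)  ∎
    where
    open ≃-Reasoning
    Pendants : Set
    Pendants = Subtype (not ∘ keepY)
    edges : ∀ a b → edge (cone core Pendants) a b ≡ adj G (from X-split a) (from Y-split b)
    edges (inj₁ tt) b = sym (univ _)
    edges (inj₂ (x , _)) (inj₁ (y , _)) = refl
    edges (inj₂ (x , x≢u)) (inj₂ (y , pendant)) = sym (¬-not λ x~y →
      toWitnessFalse {a? = otherNeighbour? y} pendant (x , toWitnessFalse {a? = x ≟ u} x≢u , x~y))
    split : cone core Pendants ≃ fromXY G
    split = ↔-sym X-split , ↔-sym Y-split , edges

open Core using (OtherNeighbour; core; coreXY)

core-≃ : {G G' : XYGraph} (φ : G ≅ G') {u : Fin (sizeX G)} {u' : Fin (sizeX G')} →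
         to (proj₁ φ) u ≡ u' → core G u ≃ core G' u'
core-≃ {G} {G'} φ@(σ , τ , e) {u} {u'} u↦u' =
  induced-≃ {fromXY G} {fromXY G'} φ
    (λ x → False-cong (x ≟ u) (to σ x ≟ u') (apex⇔ x))
    (λ y → True-cong (Core.otherNeighbour? G u y) (Core.otherNeighbour? G' u' (to τ y))
                     (neighbour⇔ y))
  where
  apex⇔ : ∀ x → x ≡ u ⇔ to σ x ≡ u'
  apex⇔ x = mk⇔ (λ { refl → u↦u' })
                (λ σx≡u' → Injection.injective (↔⇒↣ σ) (trans σx≡u' (sym u↦u')))
  neighbour⇔ : ∀ y → OtherNeighbour G u y ⇔ OtherNeighbour G' u' (to τ y)
  neighbour⇔ y = mk⇔
    (λ (x , x≢u , x~y) → to σ x , x≢u ∘ Equivalence.from (apex⇔ x) , trans (sym (e x y)) x~y)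
    (λ (x' , x'≢u' , x'~y) → from σ x' ,
       (λ x≡u → x'≢u' (trans (sym (strictlyInverseˡ σ x')) (Equivalence.to (apex⇔ (from σ x')) x≡u))) ,
       trans (e (from σ x') y) (trans (cong (λ z → adj G' z (to τ y)) (strictlyInverseˡ σ x')) x'~y))

core-invariant : {G G' : XYGraph} → G ≅ G' → {u : Fin (sizeX G)} {u' : Fin (sizeX G')} →
                 IsUniversal G u → IsUniversal G' u' → core G u ≃ core G' u'
core-invariant {G} {G'} φ univ univ' with universal-swap G' (universal-≅ {G} {G'} φ univ) univ'
... | ψ , v↦u' = core-≃ (≃-trans {fromXY G} {fromXY G'} {fromXY G'} φ ψ) v↦u'

noIsolates⇒hasNeighbours : {H : XYGraph} → NoIsolates H → HasNeighbours (fromXY H)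
noIsolates⇒hasNeighbours {H} noIsolates y with any? (λ x → adj H x y Bool.≟ true)
... | yes neighbour   = neighbour
... | no ¬neighbour   = contradiction (λ x → ¬-not λ x~y → ¬neighbour (x , x~y)) (noIsolates y)

cone-base-neighbours : (H : Bigraph) (C : Set) (x : X H) (s : Y H ⊎ C) →
                       edge (cone H C) (inj₂ x) s ≡ true → T (inLeft s)
cone-base-neighbours H C x (inj₁ y) _ = tt

-- The inverse construction: the cone over H with m pendants, numbered as an XY-graph.
-- Its apex is vertex 0.
extend : XYGraph → ℕ → XYGraph
extend H m = number (cone (fromXY H) (Fin m)) (↔-sym sucFin) (↔-sym +↔⊎)

-- The apex is universal, so nothing is isolated and 'extend H m' is unbalanced.
extend-unbalanced : (H : XYGraph) (m : ℕ) → Unbalanced (extend H m)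
extend-unbalanced H m = (λ y isolated → contradiction (isolated zero) λ ()) , zero , λ _ → refl

extend-order : (H : XYGraph) {n : ℕ} → order H < n → order (extend H (n ∸ suc (order H))) ≡ n
extend-order H lt = trans (cong suc (sym (+-assoc (sizeX H) (sizeY H) _))) (m+[n∸m]≡n lt)

-- The core of 'extend H m' at its apex is H again, provided H has no isolates: then
-- the Y-vertices of H keep a neighbour and exactly the pendants are deleted.
core-extend : (H : XYGraph) (m : ℕ) → NoIsolates H → core (extend H m) zero ≃ fromXY H
core-extend H m noIsolates = begin
  core (extend H m) zero         ≈⟨ induced-≃ {fromXY (extend H m)} {Cone} unnumber keep-x keep-y ⟩
  induced Cone inRight inLeft    ≈⟨ cone-base (fromXY H) (Fin m) ⟩
  fromXY H                       ∎
  where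
  open ≃-Reasoning
  Cone : Bigraph
  Cone = cone (fromXY H) (Fin m)
  unnumber : fromXY (extend H m) ≃ Cone
  unnumber = ≃-sym {Cone} (number-≃ Cone (↔-sym sucFin) (↔-sym +↔⊎))
  -- On X both predicates say "not the apex"; they compute to the same type.
  keep-x : ∀ a → T (Core.keepX (extend H m) zero a) ⇔ T (inRight (to sucFin a))
  keep-x zero    = ⇔-id _
  keep-x (suc _) = ⇔-id _
  -- On Y both say "a vertex of H": such a vertex has a neighbour in H, while a
  -- pendant is adjacent to the apex only.
  base-neighbour : ∀ y s → splitAt (sizeY H) y ≡ s → T (inLeft s) → OtherNeighbour (extend H m) zero y
  base-neighbour y (inj₁ y') y↦y' _ with noIsolates⇒hasNeighbours noIsolates y'
  ... | x , x~y' = suc x , (λ ()) , trans (cong (edge Cone (inj₂ x)) y↦y') x~y'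
  neighbour⇔ : ∀ y → OtherNeighbour (extend H m) zero y ⇔ T (inLeft (splitAt (sizeY H) y))
  neighbour⇔ y = mk⇔
    (λ { (zero , zero≢zero , _) → contradiction refl zero≢zero
       ; (suc x , _ , x~y) → cone-base-neighbours (fromXY H) (Fin m) x (splitAt (sizeY H) y) x~y })
    (base-neighbour y _ refl)
  keep-y : ∀ y → T (Core.keepY (extend H m) zero y) ⇔ T (inLeft (splitAt (sizeY H) y))
  keep-y y = mk⇔ (Equivalence.to (neighbour⇔ y) ∘ toWitness)
                 (fromWitness ∘ Equivalence.from (neighbour⇔ y))

pendants-determined : {G G' : XYGraph} {u : Fin (sizeX G)} {u' : Fin (sizeX G')} →
                      order G ≡ order G' → coreXY G u ≅ coreXY G' u' →
                      Core.pendants G u ≡ Core.pendants G' u'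
pendants-determined {G} {G'} {u} {u'} orders cores =
  +-cancelˡ-≡ (order (coreXY G u)) _ _ (begin
    order (coreXY G u) + Core.pendants G u      ≡⟨ suc-injective (begin
      suc (order (coreXY G u) + Core.pendants G u)    ≡⟨ Core.order-split G u ⟨
      order G                                         ≡⟨ orders ⟩
      order G'                                        ≡⟨ Core.order-split G' u' ⟩
      suc (order (coreXY G' u') + Core.pendants G' u') ∎) ⟩
    order (coreXY G' u') + Core.pendants G' u'
      ≡⟨ cong (_+ Core.pendants G' u') (≅-order {coreXY G u} {coreXY G' u'} cores) ⟨
    order (coreXY G u) + Core.pendants G' u'    ∎)
  where open ≡-Reasoning

-- The core map is a bijection on isomorphism classes.
theorem3p6 : (n : ℕ) → 1 ≤ n →
    Σ (UnbalancedOn n → NoIsolatesBelow n) λ f →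
      IsoClassBijection {UnbalancedOn n} {NoIsolatesBelow n} proj₁ proj₁ f
theorem3p6 n _ = forward , respects , reflects , covers
  where
  open ≃-Reasoning
  forward : UnbalancedOn n → NoIsolatesBelow n
  forward (G , order≡n , _ , u , _) =
    coreXY G u , Core.coreXY-smaller G u order≡n , Core.coreXY-noIsolates G u

  respects : ∀ a a' → proj₁ a ≅ proj₁ a' → proj₁ (forward a) ≅ proj₁ (forward a')
  respects (G , _ , _ , u , univ) (G' , _ , _ , u' , univ') G≅G' = begin
    fromXY (coreXY G u)    ≈⟨ Core.core≃coreXY G u ⟨
    core G u               ≈⟨ core-invariant G≅G' univ univ' ⟩
    core G' u'             ≈⟨ Core.core≃coreXY G' u' ⟩
    fromXY (coreXY G' u')  ∎

  reflects : ∀ a a' → proj₁ (forward a) ≅ proj₁ (forward a') → proj₁ a ≅ proj₁ a'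
  reflects (G , order≡n , _ , u , univ) (G' , order'≡n , _ , u' , univ') cores = begin
    fromXY G                                                  ≈⟨ Core.decomposition G u univ ⟩
    cone (fromXY (coreXY G u)) (Fin (Core.pendants G u))      ≈⟨ cones ⟩
    cone (fromXY (coreXY G' u')) (Fin (Core.pendants G' u'))  ≈⟨ Core.decomposition G' u' univ' ⟨
    fromXY G'                                                 ∎
    where
    same-pendants : Core.pendants G u ≡ Core.pendants G' u'
    same-pendants = pendants-determined {G} {G'} {u} {u'} (trans order≡n (sym order'≡n)) cores
    cones : cone (fromXY (coreXY G u)) (Fin (Core.pendants G u))
          ≃ cone (fromXY (coreXY G' u')) (Fin (Core.pendants G' u'))
    cones = cone-≃ {fromXY (coreXY G u)} {fromXY (coreXY G' u')} cores (cast-id same-pendants)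

  covers : ∀ b → ∃ λ a → proj₁ (forward a) ≅ proj₁ b
  covers (H , order<n , noIsolates) =
    (extend H m , extend-order H order<n , extend-unbalanced H m) , (begin
      fromXY (coreXY (extend H m) zero)  ≈⟨ Core.core≃coreXY (extend H m) zero ⟨
      core (extend H m) zero             ≈⟨ core-extend H m noIsolates ⟩
      fromXY H                           ∎)
    where m = n ∸ suc (order H)
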